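{- Let $\mathsf{Var}$ be a set and let all notation be as in the context. For every $N \in \mathsf{Nf}$, we have $\mathsf{nf}(\mathsf{emb}\,N) = N$, and (so that $\mathsf{nm}(\mathsf{emb}\,N)$ is a map expression $\mathsf{emb}\,N \Rightarrow \mathsf{emb}\,N$) $\mathsf{nm}(\mathsf{emb}\,N) \doteq \mathsf{id}$.
   Context: Fix a set $\mathsf{Var}$. Object expressions $\mathsf{Tm}$: for $X \in \mathsf{Var}$, $\mathsf{v}\,X \in \mathsf{Tm}$; $\mathsf{I} \in \mathsf{Tm}$; if $A,B\in\mathsf{Tm}$ then $A\otimes B \in \mathsf{Tm}$. For $A,B \in \mathsf{Tm}$, map expressions $A \Rightarrow B$ are generated by: $\mathsf{id} : A \Rightarrow A$; $f \circ g : A \Rightarrow C$ for $f : B \Rightarrow C$, $g : A \Rightarrow B$; $f \otimes g : A\otimes B \Rightarrow C \otimes D$ for $f : A \Rightarrow C$, $g : B \Rightarrow D$; $\lambda : \mathsf{I}\otimes A \Rightarrow A$; $\rho : A \Rightarrow A \otimes \mathsf{I}$; $\alpha : (A\otimes B)\otimes C \Rightarrow A\otimes(B\otimes C)$. The relation $\doteq$ between map expressions of the same type is the smallest relation closed under: reflexivity, symmetry, transitivity; if $f \doteq g$ and $h \doteq k$ then $f\circ h \doteq g \circ k$ and $f \otimes h \doteq g\otimes k$; $\mathsf{id}\circ f \doteq f$; $f \doteq f\circ \mathsf{id}$; $(f\circ g)\circ h \doteq f\circ(g\circ h)$; $\mathsf{id}\otimes\mathsf{id} \doteq \mathsf{id}$;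 $(h\circ f)\otimes(k\circ g) \doteq (h\otimes k)\circ(f\otimes g)$; $\lambda\circ(\mathsf{id}\otimes f) \doteq f\circ\lambda$; $\rho\circ f \doteq (f\otimes\mathsf{id})\circ\rho$; $\alpha\circ((f\otimes g)\otimes h) \doteq (f\otimes(g\otimes h))\circ\alpha$; $\lambda\circ\rho \doteq \mathsf{id}$ (on $\mathsf{I}$); $\mathsf{id} \doteq (\mathsf{id}\otimes\lambda)\circ\alpha\circ(\rho\otimes\mathsf{id})$ (on $A \otimes B$); $\lambda\circ\alpha \doteq \lambda\otimes\mathsf{id}$; $\alpha\circ\rho \doteq \mathsf{id}\otimes\rho$; $\alpha\circ\alpha \doteq (\mathsf{id}\otimes\alpha)\circ\alpha\circ(\alpha\otimes\mathsf{id})$ (all instances well-typed). Normal forms $\mathsf{Nf}$: $\mathsf{J}\in\mathsf{Nf}$; $X \mathbin{`\otimes} N \in \mathsf{Nf}$ for $X\in\mathsf{Var}$, $N\in\mathsf{Nf}$. $\mathsf{emb}\,\mathsf{J} = \mathsf{I}$, $\mathsf{emb}(X \mathbin{`\otimes} N) = \mathsf{v}\,X\otimes\mathsf{emb}\,N$. $\mathsf{nf}'_{\mathsf{v}X}\,N = X \mathbin{`\otimes} N$, $\mathsf{nf}'_{\mathsf{I}}\,N = N$, $\mathsf{nf}'_{A\otimes B}\,N = \mathsf{nf}'_A(\mathsf{nf}'_B\,N)$; $\mathsf{nf}\,A = \mathsf{nf}'_A\,\mathsf{J}$. The map expressions $\mathsf{nm}'_A\,N : A\otimes\mathsf{emb}\,N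 \Rightarrow \mathsf{emb}(\mathsf{nf}'_A\,N)$ are defined recursively on $A$ by $\mathsf{nm}'_{\mathsf{v}X}\,N = \mathsf{id}$, $\mathsf{nm}'_{\mathsf{I}}\,N = \lambda$, $\mathsf{nm}'_{A\otimes B}\,N = \mathsf{nm}'_A(\mathsf{nf}'_B\,N)\circ(\mathsf{id}\otimes\mathsf{nm}'_B\,N)\circ\alpha$; and $\mathsf{nm}\,A : A \Rightarrow \mathsf{emb}(\mathsf{nf}\,A)$ is $\mathsf{nm}\,A = \mathsf{nm}'_A\,\mathsf{J}\circ\rho$. -}

module Defs where

-- Free monoidal category (skew-flavoured presentation as in the paper),
-- parameterised over an arbitrary type of variables Var.
module FreeMon (Var : Set) where

  infixr 6 _⊗_
  data Tm : Set where
    v   : Var → Tm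
    I   : Tm
    _⊗_ : Tm → Tm → Tm

  infix 4 _⇒_
  infixr 9 _∘_
  infixr 6 _⊗m_
  data _⇒_ : Tm → Tm → Set where
    id   : ∀ {A} → A ⇒ A
    _∘_  : ∀ {A B C} → B ⇒ C → A ⇒ B → A ⇒ C
    _⊗m_ : ∀ {A B C D} → A ⇒ C → B ⇒ D → A ⊗ B ⇒ C ⊗ D
    λ'   : ∀ {A} → I ⊗ A ⇒ A
    ρ    : ∀ {A} → A ⇒ A ⊗ I
    α    : ∀ {A B C} → (A ⊗ B) ⊗ C ⇒ A ⊗ (B ⊗ C)

  infix 3 _≐_
  data _≐_ : ∀ {A B} → A ⇒ B → A ⇒ B → Set where
    refl≐  : ∀ {A B} {f : A ⇒ B} → f ≐ f
    sym≐   : ∀ {A B} {f g : A ⇒ B} → f ≐ g → g ≐ f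
    _∙_    : ∀ {A B} {f g h : A ⇒ B} → f ≐ g → g ≐ h → f ≐ h
    _∘≐_   : ∀ {A B C} {f g : B ⇒ C} {h k : A ⇒ B} → f ≐ g → h ≐ k → f ∘ h ≐ g ∘ k
    _⊗≐_   : ∀ {A B C D} {f g : A ⇒ C} {h k : B ⇒ D} → f ≐ g → h ≐ k → f ⊗m h ≐ g ⊗m k
    lid    : ∀ {A B} {f : A ⇒ B} → id ∘ f ≐ f
    rid    : ∀ {A B} {f : A ⇒ B} → f ≐ f ∘ id
    ass    : ∀ {A B C D} {f : C ⇒ D} {g : B ⇒ C} {h : A ⇒ B} → (f ∘ g) ∘ h ≐ f ∘ (g ∘ h)
    f⊗id   : ∀ {A B} → id {A} ⊗m id {B} ≐ id
    f⊗∘    : ∀ {A B C D E F} {f : A ⇒ B} {g : D ⇒ E} {h : B ⇒ C} {k : E ⇒ F}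
             → (h ∘ f) ⊗m (k ∘ g) ≐ (h ⊗m k) ∘ (f ⊗m g)
    nl     : ∀ {A B} {f : A ⇒ B} → λ' ∘ (id ⊗m f) ≐ f ∘ λ'
    nρ     : ∀ {A B} {f : A ⇒ B} → ρ ∘ f ≐ (f ⊗m id) ∘ ρ
    nα     : ∀ {A B C D E F} {f : A ⇒ D} {g : B ⇒ E} {h : C ⇒ F}
             → α ∘ ((f ⊗m g) ⊗m h) ≐ (f ⊗m (g ⊗m h)) ∘ α
    lρ     : λ' ∘ ρ ≐ id {I}
    lαρ    : ∀ {A B} → id {A ⊗ B} ≐ (id ⊗m λ') ∘ α ∘ (ρ ⊗m id)
    lα     : ∀ {A B} → λ' ∘ α {I} {A} {B} ≐ λ' ⊗m id
    αρ     : ∀ {A B} → α {A} {B} {I} ∘ ρ ≐ id ⊗m ρ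
    pent   : ∀ {A B C D} → α {A} {B} {C ⊗ D} ∘ α ≐ (id ⊗m α) ∘ α ∘ (α ⊗m id)

  infixr 5 _`⊗_
  data Nf : Set where
    J    : Nf
    _`⊗_ : Var → Nf → Nf

  emb : Nf → Tm
  emb J = I
  emb (X `⊗ N) = v X ⊗ emb N

  nf' : Tm → Nf → Nf
  nf' (v X) N = X `⊗ N
  nf' I N = N
  nf' (A ⊗ B) N = nf' A (nf' B N)

  nf : Tm → Nf
  nf A = nf' A J

  nm' : (A : Tm) (N : Nf) → A ⊗ emb N ⇒ emb (nf' A N)
  nm' (v X) N = id
  nm' I N = λ'
  nm' (A ⊗ B) N = nm' A (nf' B N) ∘ (id ⊗m nm' B N) ∘ α

  nm : (A : Tm) → A ⇒ emb (nf A)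
  nm A = nm' A J ∘ ρ

module Submission where

-- The equation on objects is immediate, since nf (v X ⊗ A) is X `⊗ nf A.
-- For maps the key fact is that normalising an object with a variable at
-- its head acts as the identity on that variable:
--   nm (v X ⊗ A) ≐ id ⊗m nm A,
-- which follows from the axiom α ∘ ρ ≐ id ⊗m ρ and functoriality of ⊗.
-- The base case J is the axiom λ ∘ ρ ≐ id.  In the step case we move the
-- transport under id ⊗m _, apply the induction hypothesis, and finish
-- with id ⊗m id ≐ id.

open import Defs
open import Data.Product using (Σ; _,_)
open import Relation.Binary.PropositionalEquality
  using (_≡_; refl; cong; subst)
open import Level using (0ℓ)
open import Relation.Binary.Bundles using (Setoid)
import Relation.Binary.Reasoning.Setoid as SetoidReasoning

module NormalFormsAreFixed (Var : Set) where
  open FreeMon Var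

  ≐-setoid : Tm → Tm → Setoid 0ℓ 0ℓ
  ≐-setoid A B = record
    { Carrier       = A ⇒ B
    ; _≈_           = _≐_
    ; isEquivalence = record { refl = refl≐ ; sym = sym≐ ; trans = _∙_ }
    }

  subst-≐ : ∀ {A} {M N : Nf} (p : M ≡ N) {f g : A ⇒ emb M} → f ≐ g →
    subst (λ K → A ⇒ emb K) p f ≐ subst (λ K → A ⇒ emb K) p g
  subst-≐ refl f≐g = f≐g

  subst-id⊗ : ∀ {A} X {M N : Nf} (p : M ≡ N) (f : A ⇒ emb M) →
    subst (λ K → v X ⊗ A ⇒ emb K) (cong (X `⊗_) p) (id ⊗m f)
      ≡ id ⊗m subst (λ K → A ⇒ emb K) p f
  subst-id⊗ X refl f = refl

  -- Normalising an object with a variable at its head leaves the variable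
  -- alone: nm (v X ⊗ A) = (id ∘ (id ⊗m nm' A J) ∘ α) ∘ ρ, and α ∘ ρ
  -- becomes id ⊗m ρ, which then merges with id ⊗m nm' A J.
  nm-var : ∀ X A → nm (v X ⊗ A) ≐ id ⊗m nm A
  nm-var X A = begin
    (id ∘ (id ⊗m n) ∘ α) ∘ ρ    ≈⟨ ass ⟩
    id ∘ ((id ⊗m n) ∘ α) ∘ ρ    ≈⟨ lid ⟩
    ((id ⊗m n) ∘ α) ∘ ρ         ≈⟨ ass ⟩
    (id ⊗m n) ∘ α ∘ ρ           ≈⟨ refl≐ ∘≐ αρ ⟩
    (id ⊗m n) ∘ (id ⊗m ρ)       ≈⟨ sym≐ f⊗∘ ⟩
    (id ∘ id) ⊗m (n ∘ ρ)        ≈⟨ lid ⊗≐ refl≐ ⟩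
    id ⊗m nm A                  ∎
    where
      n : A ⊗ I ⇒ emb (nf A)
      n = nm' A J
      open SetoidReasoning (≐-setoid (v X ⊗ A) (emb (nf (v X ⊗ A))))

  nf-emb : (N : Nf) → nf (emb N) ≡ N
  nf-emb J        = refl
  nf-emb (X `⊗ N) = cong (X `⊗_) (nf-emb N)

  nm-emb : (N : Nf) →
    subst (λ M → emb N ⇒ emb M) (nf-emb N) (nm (emb N)) ≐ id
  nm-emb J        = lρ
  nm-emb (X `⊗ N) = begin
    subst P (cong (X `⊗_) p) (nm (v X ⊗ emb N))      ≈⟨ subst-≐ (cong (X `⊗_) p) (nm-var X (emb N)) ⟩
    subst P (cong (X `⊗_) p) (id ⊗m nm (emb N))      ≡⟨ subst-id⊗ X p (nm (emb N)) ⟩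
    id ⊗m subst (λ M → emb N ⇒ emb M) p (nm (emb N)) ≈⟨ refl≐ ⊗≐ nm-emb N ⟩
    id ⊗m id                                         ≈⟨ f⊗id ⟩
    id                                               ∎
    where
      p : nf (emb N) ≡ N
      p = nf-emb N
      P : Nf → Set
      P M = v X ⊗ emb N ⇒ emb M
      open SetoidReasoning (≐-setoid (v X ⊗ emb N) (v X ⊗ emb N))

proposition5 : (Var : Set) → let open FreeMon Var in
    (N : Nf) → Σ (nf (emb N) ≡ N)
      (λ p → subst (λ M → emb N ⇒ emb M) p (nm (emb N)) ≐ id)
proposition5 Var N = nf-emb N , nm-emb N
  where open NormalFormsAreFixed Var
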